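{- For every integer $m\geq 3$, $\mbox{min-seed}(C_m\oslash C_3,3)=m+1$.
   Context: The $m\times n$ torus cordalis $C_m\oslash C_n$ has vertex set $\{(i,j):1\leq i\leq m,\ 1\leq j\leq n\}$; its edges are those of the toroidal mesh $C_m\Box C_n$ (where $(i,j)$ is adjacent to $(i\pm1,j)$ and $(i,j\pm1)$, first coordinate modulo $m$, second modulo $n$), except that for each $1\leq i\leq m$ the edge $(i,n)(i,1)$ is replaced by the edge $(i,n)(i+1,1)$ (first coordinate modulo $m$). For a graph $G$ and positive integer $k$, the activation process in $(G,k)$ starting at $S\subseteq V(G)$: at time $0$ exactly the vertices of $S$ are active; at each subsequent step every inactive vertex with at least $k$ active neighbors becomes active; active vertices stay active; the process stops when nothing changes. $\mbox{min-seed}(G,k)$ is the minimum size of a set $S\subseteq V(G)$ such that at the end of this process all vertices of $G$ are active. -}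

module Defs where

open import Data.Nat using (ℕ; zero; suc; _≤_; _≤ᵇ_; _<?_; NonZero)
open import Data.Nat.DivMod using (_%_; m%n<n)
open import Data.Fin using (Fin; toℕ; fromℕ<) renaming (_≟_ to _≟ᶠ_)
open import Data.Bool using (Bool; true; false; _∨_; _∧_; not) renaming (_≟_ to _≟ᵇ_)
open import Data.Product using (_×_; _,_; ∃)
open import Data.Product.Properties using (≡-dec)
open import Data.List using (List; allFin; cartesianProduct; filter; length)
open import Relation.Nullary using (Dec; yes; no)
open import Relation.Nullary.Decidable using (⌊_⌋)
open import Relation.Binary.PropositionalEquality using (_≡_)

-- The graph is given by a list `vs` enumerating its vertices (each
-- exactly once) and a Boolean adjacency relation `adj`.

module Activation {V : Set} (vs : List V) (adj : V → V → Bool) where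

  size : (V → Bool) → ℕ
  size S = length (filter (λ u → S u ≟ᵇ true) vs)

  activeNbrs : (V → Bool) → V → ℕ
  activeNbrs A v = size (λ u → adj v u ∧ A u)

  active : ℕ → (V → Bool) → ℕ → V → Bool
  active k S zero    v = S v
  active k S (suc t) v = active k S t v ∨ (k ≤ᵇ activeNbrs (active k S t) v)

  -- at the end of the process all vertices are active
  -- (the process is monotone, so this means: at some time all are active)
  Percolates : ℕ → (V → Bool) → Set
  Percolates k S = ∃ λ t → ∀ v → active k S t v ≡ true

  MinSeedIs : ℕ → ℕ → Set
  MinSeedIs k s =
    (∃ λ S → size S ≡ s × Percolates k S) ×
    (∀ S → Percolates k S → s ≤ size S)

-- The torus cordalis C_m ⊘ C_n, 0-indexed: vertex (i , j) with i < m,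
-- j < n stands for the paper's (i+1 , j+1).

CVertex : ℕ → ℕ → Set
CVertex m n = Fin m × Fin n

cVertices : (m n : ℕ) → List (CVertex m n)
cVertices m n = cartesianProduct (allFin m) (allFin n)

sucMod : (m : ℕ) → Fin m → Fin m
sucMod (suc k) i = fromℕ< (m%n<n (suc (toℕ i)) (suc k))

down : (m n : ℕ) → CVertex m n → CVertex m n
down m n (i , j) = (sucMod m i , j)

-- "horizontal" successor: (i , j+1) if j+1 < n; for j = n-1 it is
-- (i+1 mod m , 0), the chord replacing the toroidal edge (i,n)(i,1)
right : (m n : ℕ) → CVertex m n → CVertex m n
right m n (i , j) with suc (toℕ j) <? n
... | yes p = (i , fromℕ< p)
... | no _  = (sucMod m i , fromℕ< (Data.Nat.Properties.≤-<-trans Data.Nat.z≤n (Data.Fin.Properties.toℕ<n j)))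
  where import Data.Nat
        import Data.Nat.Properties
        import Data.Fin.Properties

_≟ᵛ_ : {m n : ℕ} → (a b : CVertex m n) → Dec (a ≡ b)
_≟ᵛ_ = ≡-dec _≟ᶠ_ _≟ᶠ_

-- adjacency in C_m ⊘ C_n: b is the vertical or horizontal successor of
-- a, or vice versa (and a ≠ b: the graph is simple, no loops)
cAdj : (m n : ℕ) → CVertex m n → CVertex m n → Bool
cAdj m n a b =
  not ⌊ a ≟ᵛ b ⌋ ∧
  (⌊ b ≟ᵛ down m n a ⌋ ∨ ⌊ a ≟ᵛ down m n b ⌋ ∨
   ⌊ b ≟ᵛ right m n a ⌋ ∨ ⌊ a ≟ᵛ right m n b ⌋)

module TorusCordalis (m n : ℕ) =
  Activation (cVertices m n) (cAdj m n)

MinSeedCordalis : (m n : ℕ) → ℕ → ℕ → Set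
MinSeedCordalis m n k s = TorusCordalis.MinSeedIs m n k s

-- Lower bound (a counting argument valid in any finite graph).  Let E X Y
-- count ordered adjacent pairs (v , u) with v ∈ X, u ∈ Y.  A vertex
-- activated at some step has at least k active neighbours, so along the
-- process 2k ∣A t∣ ≤ 2k ∣S∣ + E (A t) (A t).  In a d-regular graph the
-- step that completes the process gains d - k more, so a percolating S
-- is everything or satisfies 2kN + d ≤ 2k∣S∣ + dN + k.  For C_m ⊘ C_3
-- (4-regular, N = 3m, k = 3) this reads 6m + 1 ≤ 6∣S∣, i.e. ∣S∣ ≥ m + 1.
--
-- Upper bound (an activation schedule).  If every vertex outside S has k
-- neighbours of smaller rank, S percolates.  We exhibit ranks on
-- C_m ⊘ C_3 whose rank-0 vertices (one per row plus one) form such an S.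

module Submission where

open import Defs
open import Data.Nat using (ℕ; _≤_; _+_)

open import Data.Nat using (zero; suc; _*_; _<_; _≤ᵇ_; _<ᵇ_; _≡ᵇ_; _%_; z≤n; s≤s)
open import Data.Nat.DivMod using (m<n⇒m%n≡m; n%n≡0)
open import Data.Nat.Properties
open import Data.Nat.Tactic.RingSolver using (solve-∀)
open import Data.Bool using (Bool; true; false; _∧_; _∨_; not; T; if_then_else_) renaming (_≟_ to _≟ᵇ_)
open import Data.Bool.Properties using (T-≡; T-∧; T-∨; ∨-comm)
open import Data.Fin using (Fin; zero; suc; toℕ; fromℕ; inject₁)
open import Data.Fin.Properties using (toℕ-fromℕ<; toℕ-fromℕ; toℕ-inject₁; toℕ-injective; toℕ<n)
open import Data.List using (List; []; _∷_; map; _++_; filter; length; allFin; tabulate; cartesianProduct)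
open import Data.List.Relation.Unary.All as All using (All; []; _∷_)
open import Data.List.Relation.Unary.All.Properties using (All¬⇒¬Any)
open import Data.List.Relation.Unary.Any using (here; there)
open import Data.List.Relation.Unary.AllPairs using ([]; _∷_)
open import Data.List.Relation.Unary.Unique.Propositional using (Unique)
open import Data.List.Relation.Unary.Unique.Propositional.Properties using (cartesianProduct⁺; allFin⁺)
open import Data.List.Membership.Propositional using (_∈_; _∉_)
open import Data.List.Membership.Propositional.Properties using (∈-cartesianProduct⁺; ∈-allFin)
open import Data.Product using (_×_; _,_; proj₁; proj₂)
open import Data.Sum using (_⊎_; inj₁; inj₂)
open import Function.Bundles using (Equivalence)
open import Relation.Binary.Definitions using (DecidableEquality)
open import Relation.Binary.PropositionalEquality
open import Relation.Nullary using (Dec; yes; no; ¬_; contradiction)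
open import Relation.Nullary.Decidable using (⌊_⌋; toWitness; toWitnessFalse; fromWitness; fromWitnessFalse)

⟦_⟧ : Bool → ℕ
⟦ true ⟧ = 1
⟦ false ⟧ = 0

⟦∧⟧ : ∀ a b → ⟦ a ∧ b ⟧ ≡ ⟦ a ⟧ * ⟦ b ⟧
⟦∧⟧ true  true  = refl
⟦∧⟧ true  false = refl
⟦∧⟧ false b     = refl

⟦∨⟧ : ∀ a c → ⟦ a ∨ c ⟧ ≡ ⟦ a ⟧ + ⟦ not a ∧ c ⟧
⟦∨⟧ true  c = refl
⟦∨⟧ false c = refl

⌊⌋-true : ∀ {P : Set} (d : Dec P) → P → ⌊ d ⌋ ≡ true
⌊⌋-true (yes _) _ = refl
⌊⌋-true (no ¬p) p = contradiction p ¬p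

⌊⌋-false : ∀ {P : Set} (d : Dec P) → ¬ P → ⌊ d ⌋ ≡ false
⌊⌋-false (yes p) ¬p = contradiction p ¬p
⌊⌋-false (no _)  _  = refl

⌊≟⌋-sym : ∀ {A : Set} (_≟_ : DecidableEquality A) a b → ⌊ a ≟ b ⌋ ≡ ⌊ b ≟ a ⌋
⌊≟⌋-sym _≟_ a b with a ≟ b
... | yes a≡b = sym (⌊⌋-true (b ≟ a) (sym a≡b))
... | no  a≢b = sym (⌊⌋-false (b ≟ a) (λ b≡a → a≢b (sym b≡a)))

module _ {A : Set} where

  ∑ : List A → (A → ℕ) → ℕ
  ∑ []       f = 0
  ∑ (x ∷ xs) f = f x + ∑ xs f

  ∑-cong : ∀ xs {f g : A → ℕ} → (∀ x → f x ≡ g x) → ∑ xs f ≡ ∑ xs g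
  ∑-cong []       f≡g = refl
  ∑-cong (x ∷ xs) f≡g = cong₂ _+_ (f≡g x) (∑-cong xs f≡g)

  ∑-mono : ∀ xs {f g : A → ℕ} → (∀ x → f x ≤ g x) → ∑ xs f ≤ ∑ xs g
  ∑-mono []       f≤g = z≤n
  ∑-mono (x ∷ xs) f≤g = +-mono-≤ (f≤g x) (∑-mono xs f≤g)

  ∑-+ : ∀ xs (f g : A → ℕ) → ∑ xs (λ x → f x + g x) ≡ ∑ xs f + ∑ xs g
  ∑-+ []       f g = refl
  ∑-+ (x ∷ xs) f g = begin
      (f x + g x) + ∑ xs (λ x → f x + g x) ≡⟨ cong ((f x + g x) +_) (∑-+ xs f g) ⟩
      (f x + g x) + (∑ xs f + ∑ xs g)       ≡⟨ +-+-swap (f x) (g x) (∑ xs f) (∑ xs g) ⟩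
      (f x + ∑ xs f) + (g x + ∑ xs g)       ∎
    where
      open ≡-Reasoning
      +-+-swap : ∀ a b c d → (a + b) + (c + d) ≡ (a + c) + (b + d)
      +-+-swap = solve-∀

  ∑-*ˡ : ∀ xs c (f : A → ℕ) → ∑ xs (λ x → c * f x) ≡ c * ∑ xs f
  ∑-*ˡ []       c f = sym (*-zeroʳ c)
  ∑-*ˡ (x ∷ xs) c f =
    trans (cong (c * f x +_) (∑-*ˡ xs c f)) (sym (*-distribˡ-+ c (f x) (∑ xs f)))

  ∑-zero : ∀ xs → ∑ xs (λ _ → 0) ≡ 0
  ∑-zero []       = refl
  ∑-zero (x ∷ xs) = ∑-zero xs

  ∈⇒≤∑ : ∀ {xs x} (f : A → ℕ) → x ∈ xs → f x ≤ ∑ xs f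
  ∈⇒≤∑ {y ∷ ys} f (here refl) = m≤m+n (f y) (∑ ys f)
  ∈⇒≤∑ {y ∷ ys} f (there x∈) = ≤-trans (∈⇒≤∑ f x∈) (m≤n+m (∑ ys f) (f y))

  ∑-++ : ∀ xs ys (f : A → ℕ) → ∑ (xs ++ ys) f ≡ ∑ xs f + ∑ ys f
  ∑-++ []       ys f = refl
  ∑-++ (x ∷ xs) ys f = trans (cong (f x +_) (∑-++ xs ys f)) (sym (+-assoc (f x) _ _))

∑-map : ∀ {A B : Set} (g : A → B) xs (f : B → ℕ) → ∑ (map g xs) f ≡ ∑ xs (λ x → f (g x))
∑-map g []       f = refl
∑-map g (x ∷ xs) f = cong (f (g x) +_) (∑-map g xs f)

∑-swap : ∀ {A B : Set} xs ys (h : A → B → ℕ) →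
         ∑ xs (λ x → ∑ ys (λ y → h x y)) ≡ ∑ ys (λ y → ∑ xs (λ x → h x y))
∑-swap []       ys h = sym (∑-zero ys)
∑-swap (x ∷ xs) ys h =
  trans (cong (∑ ys (h x) +_) (∑-swap xs ys h)) (sym (∑-+ ys (h x) (λ y → ∑ xs (λ x → h x y))))

∑-cartesianProduct : ∀ {A B : Set} xs ys (h : A × B → ℕ) →
                     ∑ (cartesianProduct xs ys) h ≡ ∑ xs (λ x → ∑ ys (λ y → h (x , y)))
∑-cartesianProduct []       ys h = refl
∑-cartesianProduct (x ∷ xs) ys h =
  trans (∑-++ (map (x ,_) ys) _ h)
        (cong₂ _+_ (∑-map (x ,_) ys h) (∑-cartesianProduct xs ys h))

∑-tabulate-const : ∀ {A : Set} n (g : Fin n → A) c → ∑ (tabulate g) (λ _ → c) ≡ n * c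
∑-tabulate-const zero    g c = refl
∑-tabulate-const (suc n) g c = cong (c +_) (∑-tabulate-const n (λ i → g (suc i)) c)

module PointSums {A : Set} (_≟_ : DecidableEquality A) where

  ∑-point-∉ : ∀ {xs a} (f : A → ℕ) → a ∉ xs → ∑ xs (λ u → ⟦ ⌊ u ≟ a ⌋ ⟧ * f u) ≡ 0
  ∑-point-∉ {[]}     f a∉ = refl
  ∑-point-∉ {x ∷ xs} {a} f a∉
    rewrite ⌊⌋-false (x ≟ a) (λ x≡a → a∉ (here (sym x≡a))) = ∑-point-∉ f (λ a∈ → a∉ (there a∈))

  ∑-point : ∀ {xs a} (f : A → ℕ) → Unique xs → a ∈ xs → ∑ xs (λ u → ⟦ ⌊ u ≟ a ⌋ ⟧ * f u) ≡ f a
  ∑-point {x ∷ xs} f (x≢ ∷ _) (here refl)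
    rewrite ⌊⌋-true (x ≟ x) refl | ∑-point-∉ {xs} f (All¬⇒¬Any x≢) = trans (+-identityʳ _) (+-identityʳ _)
  ∑-point {x ∷ xs} {a} f (x≢ ∷ unique) (there a∈)
    rewrite ⌊⌋-false (x ≟ a) (All.lookup x≢ a∈) = ∑-point f unique a∈

module Counting {V : Set} (vs : List V) (adj : V → V → Bool) where

  open Activation vs adj

  ∣_∣ : (V → Bool) → ℕ
  ∣ X ∣ = ∑ vs (λ v → ⟦ X v ⟧)

  N : ℕ
  N = ∣ (λ _ → true) ∣

  nb : (V → Bool) → V → ℕ
  nb X v = ∣ (λ u → adj v u ∧ X u) ∣

  size≡∣∣ : ∀ X → size X ≡ ∣ X ∣
  size≡∣∣ X = go vs
    where
      go : ∀ xs → length (filter (λ u → X u ≟ᵇ true) xs) ≡ ∑ xs (λ v → ⟦ X v ⟧)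
      go []       = refl
      go (x ∷ xs) with X x
      ... | true  = cong suc (go xs)
      ... | false = go xs

  activeNbrs≡nb : ∀ X v → activeNbrs X v ≡ nb X v
  activeNbrs≡nb X v = size≡∣∣ (λ u → adj v u ∧ X u)

  activeNbrs-mono : ∀ {X Y} v → (∀ u → T (X u) → T (Y u)) → activeNbrs X v ≤ activeNbrs Y v
  activeNbrs-mono {X} {Y} v X⊆Y = begin
      activeNbrs X v                       ≡⟨ activeNbrs≡nb X v ⟩
      ∑ vs (λ u → ⟦ adj v u ∧ X u ⟧)       ≤⟨ ∑-mono vs (λ u → pointwise (adj v u) (X u) (Y u) (X⊆Y u)) ⟩
      ∑ vs (λ u → ⟦ adj v u ∧ Y u ⟧)       ≡⟨ activeNbrs≡nb Y v ⟨
      activeNbrs Y v                       ∎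
    where
      open ≤-Reasoning
      pointwise : ∀ e x y → (T x → T y) → ⟦ e ∧ x ⟧ ≤ ⟦ e ∧ y ⟧
      pointwise false x     y     _   = z≤n
      pointwise true  false y     _   = z≤n
      pointwise true  true  true  _   = ≤-refl
      pointwise true  true  false x⇒y = contradiction (x⇒y _) (λ ())

  _∪_ _∖_ : (V → Bool) → (V → Bool) → V → Bool
  (X ∪ Y) v = X v ∨ Y v
  (Y ∖ X) v = not (X v) ∧ Y v

  ∣∪∣ : ∀ X Y → ∣ X ∪ Y ∣ ≡ ∣ X ∣ + ∣ Y ∖ X ∣
  ∣∪∣ X Y = trans (∑-cong vs (λ u → ⟦∨⟧ (X u) (Y u))) (∑-+ vs _ _)

  nb-∪ : ∀ X Y v → nb (X ∪ Y) v ≡ nb X v + nb (Y ∖ X) v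
  nb-∪ X Y v = trans (∑-cong vs (λ u → split (adj v u) (X u) (Y u))) (∑-+ vs _ _)
    where
      split : ∀ e a c → ⟦ e ∧ (a ∨ c) ⟧ ≡ ⟦ e ∧ a ⟧ + ⟦ e ∧ (not a ∧ c) ⟧
      split false a c = refl
      split true  a c = ⟦∨⟧ a c

  nb-cong : ∀ {X Y} → (∀ u → X u ≡ Y u) → ∀ v → nb X v ≡ nb Y v
  nb-cong X≡Y v = ∑-cong vs (λ u → cong (λ b → ⟦ adj v u ∧ b ⟧) (X≡Y u))

  E : (V → Bool) → (V → Bool) → ℕ
  E X Y = ∑ vs (λ v → ⟦ X v ⟧ * nb Y v)

  E-∪ : ∀ X Y → let Z = Y ∖ X in
        E (X ∪ Y) (X ∪ Y) ≡ (E X X + E X Z) + (E Z X + E Z Z)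
  E-∪ X Y = begin
      ∑ vs (λ v → ⟦ (X ∪ Y) v ⟧ * nb (X ∪ Y) v)
        ≡⟨ ∑-cong vs (λ v → cong₂ _*_ (⟦∨⟧ (X v) (Y v)) (nb-∪ X Y v)) ⟩
      ∑ vs (λ v → (⟦ X v ⟧ + ⟦ Z v ⟧) * (nb X v + nb Z v))
        ≡⟨ ∑-cong vs (λ v → expand ⟦ X v ⟧ ⟦ Z v ⟧ (nb X v) (nb Z v)) ⟩
      ∑ vs (λ v → (⟦ X v ⟧ * nb X v + ⟦ X v ⟧ * nb Z v) + (⟦ Z v ⟧ * nb X v + ⟦ Z v ⟧ * nb Z v))
        ≡⟨ ∑-+ vs _ _ ⟩
      ∑ vs (λ v → ⟦ X v ⟧ * nb X v + ⟦ X v ⟧ * nb Z v) + ∑ vs (λ v → ⟦ Z v ⟧ * nb X v + ⟦ Z v ⟧ * nb Z v)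
        ≡⟨ cong₂ _+_ (∑-+ vs _ _) (∑-+ vs _ _) ⟩
      (E X X + E X Z) + (E Z X + E Z Z) ∎
    where
      open ≡-Reasoning
      Z : V → Bool
      Z = Y ∖ X
      expand : ∀ a d x y → (a + d) * (x + y) ≡ (a * x + a * y) + (d * x + d * y)
      expand = solve-∀

  E-sym : (∀ u v → adj u v ≡ adj v u) → ∀ X Y → E X Y ≡ E Y X
  E-sym adj-sym X Y = begin
      ∑ vs (λ v → ⟦ X v ⟧ * ∑ vs (λ u → ⟦ adj v u ∧ Y u ⟧))
        ≡⟨ ∑-cong vs (λ v → sym (∑-*ˡ vs ⟦ X v ⟧ _)) ⟩
      ∑ vs (λ v → ∑ vs (λ u → ⟦ X v ⟧ * ⟦ adj v u ∧ Y u ⟧))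
        ≡⟨ ∑-cong vs (λ v → ∑-cong vs (λ u → reorder v u)) ⟩
      ∑ vs (λ v → ∑ vs (λ u → ⟦ Y u ⟧ * ⟦ adj u v ∧ X v ⟧))
        ≡⟨ ∑-swap vs vs _ ⟩
      ∑ vs (λ u → ∑ vs (λ v → ⟦ Y u ⟧ * ⟦ adj u v ∧ X v ⟧))
        ≡⟨ ∑-cong vs (λ u → ∑-*ˡ vs ⟦ Y u ⟧ _) ⟩
      ∑ vs (λ u → ⟦ Y u ⟧ * ∑ vs (λ v → ⟦ adj u v ∧ X v ⟧)) ∎
    where
      open ≡-Reasoning
      comm : ∀ x e y → x * (e * y) ≡ y * (e * x)
      comm = solve-∀
      reorder : ∀ v u → ⟦ X v ⟧ * ⟦ adj v u ∧ Y u ⟧ ≡ ⟦ Y u ⟧ * ⟦ adj u v ∧ X v ⟧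
      reorder v u rewrite ⟦∧⟧ (adj v u) (Y u) | ⟦∧⟧ (adj u v) (X v) | adj-sym u v =
        comm ⟦ X v ⟧ ⟦ adj v u ⟧ ⟦ Y u ⟧

module _ {V : Set} (_≟_ : DecidableEquality V) {vs : List V} (adj : V → V → Bool)
         (vs-unique : Unique vs) (vs-complete : ∀ v → v ∈ vs) where

  open Activation vs adj
  open Counting vs adj
  open PointSums _≟_

  activeNbrs-list : ∀ v {ns} → Unique ns →
                    (∀ u → T (adj v u) → u ∈ ns) → (∀ u → u ∈ ns → T (adj v u)) →
                    ∀ B → activeNbrs B v ≡ ∑ ns (λ a → ⟦ B a ⟧)
  activeNbrs-list v {ns} ns-unique adj⇒∈ ∈⇒adj B = begin
      activeNbrs B v
        ≡⟨ activeNbrs≡nb B v ⟩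
      ∑ vs (λ u → ⟦ adj v u ∧ B u ⟧)
        ≡⟨ ∑-cong vs (λ u → indicator (adj v u) u (adj⇒∈ u) (∈⇒adj u)) ⟩
      ∑ vs (λ u → ∑ ns (λ a → ⟦ ⌊ a ≟ u ⌋ ⟧ * ⟦ B u ⟧))
        ≡⟨ ∑-swap vs ns _ ⟩
      ∑ ns (λ a → ∑ vs (λ u → ⟦ ⌊ a ≟ u ⌋ ⟧ * ⟦ B u ⟧))
        ≡⟨ ∑-cong ns (λ a → ∑-cong vs (λ u → cong (λ b → ⟦ b ⟧ * ⟦ B u ⟧) (⌊≟⌋-sym _≟_ a u))) ⟩
      ∑ ns (λ a → ∑ vs (λ u → ⟦ ⌊ u ≟ a ⌋ ⟧ * ⟦ B u ⟧))
        ≡⟨ ∑-cong ns (λ a → ∑-point (λ u → ⟦ B u ⟧) vs-unique (vs-complete a)) ⟩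
      ∑ ns (λ a → ⟦ B a ⟧) ∎
    where
      open ≡-Reasoning
      indicator : ∀ b u → (T b → u ∈ ns) → (u ∈ ns → T b) →
                  ⟦ b ∧ B u ⟧ ≡ ∑ ns (λ a → ⟦ ⌊ a ≟ u ⌋ ⟧ * ⟦ B u ⟧)
      indicator true  u b⇒∈ _   = sym (∑-point (λ _ → ⟦ B u ⟧) ns-unique (b⇒∈ _))
      indicator false u _   ∈⇒b = sym (∑-point-∉ (λ _ → ⟦ B u ⟧) ∈⇒b)

-- Arithmetic of one step of the process: if 2k a ≤ 2k s + e and the D
-- new vertices have k neighbours counted in x and in x′, the invariant
-- persists for a + D.
step-bound : ∀ k {a D s e x′ x z} → 2 * k * a ≤ 2 * k * s + e → k * D ≤ x → k * D ≤ x′ →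
             2 * k * (a + D) ≤ 2 * k * s + ((e + x′) + (x + z))
step-bound k {a} {D} {s} {e} {x′} {x} {z} inv kD≤x kD≤x′ = begin
    2 * k * (a + D)              ≡⟨ expand k a D ⟩
    2 * k * a + (k * D + k * D)  ≤⟨ +-mono-≤ inv (+-mono-≤ kD≤x′ kD≤x) ⟩
    (2 * k * s + e) + (x′ + x)   ≤⟨ m≤m+n _ z ⟩
    (2 * k * s + e) + (x′ + x) + z ≡⟨ regroup (2 * k * s) e x′ x z ⟩
    2 * k * s + ((e + x′) + (x + z)) ∎
  where
    open ≤-Reasoning
    expand : ∀ k a D → 2 * k * (a + D) ≡ 2 * k * a + (k * D + k * D)
    expand = solve-∀
    regroup : ∀ s e x′ x z → (s + e) + (x′ + x) + z ≡ s + ((e + x′) + (x + z))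
    regroup = solve-∀

-- Arithmetic of the completing step: moreover x + z = d D with D ≥ 1,
-- and the final pair count (e + x) + (x + z) is d n.
completion-bound : ∀ {k d a D s e x z n} → k ≤ d → 1 ≤ D → 2 * k * a ≤ 2 * k * s + e → k * D ≤ x →
                   a + D ≡ n → x + z ≡ d * D → (e + x) + (x + z) ≡ d * n →
                   2 * k * n + d ≤ 2 * k * s + d * n + k
completion-bound {k} {d} {a} {suc D′} {s} {e} {x} {z} {n} k≤d _ inv kD≤x refl x+z≡dD e+x+x+z≡dn = begin
    2 * k * (a + (1 + D′)) + d
      ≡⟨ expand k a D′ d ⟩
    2 * k * a + (k * (1 + D′) + (k + (k * D′ + d)))
      ≤⟨ +-mono-≤ inv (+-mono-≤ kD≤x (+-monoʳ-≤ k (+-monoˡ-≤ d (*-monoˡ-≤ D′ k≤d)))) ⟩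
    (2 * k * s + e) + (x + (k + (d * D′ + d)))
      ≡⟨ regroup (2 * k * s) e x k d D′ ⟩
    2 * k * s + ((e + x) + d * (1 + D′)) + k
      ≡⟨ cong (λ y → 2 * k * s + ((e + x) + y) + k) x+z≡dD ⟨
    2 * k * s + ((e + x) + (x + z)) + k
      ≡⟨ cong (λ y → 2 * k * s + y + k) e+x+x+z≡dn ⟩
    2 * k * s + d * (a + (1 + D′)) + k ∎
  where
    open ≤-Reasoning
    expand : ∀ k a D′ d → 2 * k * (a + (1 + D′)) + d ≡ 2 * k * a + (k * (1 + D′) + (k + (k * D′ + d)))
    expand = solve-∀
    regroup : ∀ s e x k d D′ → (s + e) + (x + (k + (d * D′ + d))) ≡ s + ((e + x) + d * (1 + D′)) + k
    regroup = solve-∀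

-- A vertex activated at step t+1 has at least k neighbours in A t, so
-- the number E (A t) (A t) of ordered active–active adjacent pairs grows
-- by at least 2k per newly activated vertex.

module LowerBound {V : Set} (vs : List V) (adj : V → V → Bool)
                  (adj-sym : ∀ u v → adj u v ≡ adj v u) (vs-complete : ∀ v → v ∈ vs)
                  (k : ℕ) (S : V → Bool) where

  open Activation vs adj
  open Counting vs adj

  A : ℕ → V → Bool
  A = active k S

  ready : ℕ → V → Bool
  ready t v = k ≤ᵇ activeNbrs (A t) v

  new : ℕ → V → Bool
  new t = ready t ∖ A t

  new-has-k : ∀ t → k * ∣ new t ∣ ≤ E (new t) (A t)
  new-has-k t = begin
      k * ∣ new t ∣                          ≡⟨ ∑-*ˡ vs k _ ⟨
      ∑ vs (λ v → k * ⟦ new t v ⟧)           ≤⟨ ∑-mono vs pointwise ⟩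
      ∑ vs (λ v → ⟦ new t v ⟧ * nb (A t) v)  ∎
    where
      open ≤-Reasoning
      bound : ∀ b n → (T b → k ≤ n) → k * ⟦ b ⟧ ≤ ⟦ b ⟧ * n
      bound false n _   = ≤-reflexive (*-zeroʳ k)
      bound true  n k≤n = ≤-trans (≤-reflexive (*-identityʳ k)) (≤-trans (k≤n _) (m≤m+n n 0))
      pointwise : ∀ v → k * ⟦ new t v ⟧ ≤ ⟦ new t v ⟧ * nb (A t) v
      pointwise v = bound (new t v) (nb (A t) v) λ new-v →
        ≤-trans (≤ᵇ⇒≤ k _ (proj₂ (Equivalence.to T-∧ new-v))) (≤-reflexive (activeNbrs≡nb (A t) v))

  invariant : ∀ t → 2 * k * ∣ A t ∣ ≤ 2 * k * ∣ S ∣ + E (A t) (A t)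
  invariant zero    = m≤m+n (2 * k * ∣ S ∣) _
  invariant (suc t) = begin
      2 * k * ∣ A (suc t) ∣
        ≡⟨ cong (2 * k *_) (∣∪∣ (A t) (ready t)) ⟩
      2 * k * (∣ A t ∣ + ∣ new t ∣)
        ≤⟨ step-bound k (invariant t) (new-has-k t) (≤-trans (new-has-k t) (≤-reflexive (E-sym adj-sym (new t) (A t)))) ⟩
      2 * k * ∣ S ∣ + ((E (A t) (A t) + E (A t) (new t)) + (E (new t) (A t) + E (new t) (new t)))
        ≡⟨ cong (2 * k * ∣ S ∣ +_) (E-∪ (A t) (ready t)) ⟨
      2 * k * ∣ S ∣ + E (A (suc t)) (A (suc t)) ∎
    where open ≤-Reasoning

  module _ (d : ℕ) (k≤d : k ≤ d) (regular : ∀ v → activeNbrs (λ _ → true) v ≡ d) where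

    nb-complete : ∀ {X} → (∀ u → X u ≡ true) → ∀ v → nb X v ≡ d
    nb-complete X-all v = trans (nb-cong X-all v) (trans (sym (activeNbrs≡nb _ v)) (regular v))

    E-complete : ∀ {X} → (∀ u → X u ≡ true) → E X X ≡ d * N
    E-complete {X} X-all = begin
        E X X                       ≡⟨ ∑-cong vs (λ v → cong₂ _*_ (cong ⟦_⟧ (X-all v)) (nb-complete X-all v)) ⟩
        ∑ vs (λ v → 1 * d)          ≡⟨ ∑-cong vs (λ v → *-comm 1 d) ⟩
        ∑ vs (λ v → d * 1)          ≡⟨ ∑-*ˡ vs d (λ _ → 1) ⟩
        d * N                       ∎
      where open ≡-Reasoning

    -- The step completing the process: with a = ∣A t∣, D = ∣new t∣ ≥ 1,
    -- a + D = N, every new vertex has all d neighbours active afterwards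
    -- and at least k of them in A t.
    last-step : ∀ t → (∀ v → A (suc t) v ≡ true) → 1 ≤ ∣ new t ∣ →
                2 * k * N + d ≤ 2 * k * ∣ S ∣ + d * N + k
    last-step t all 1≤D = completion-bound k≤d 1≤D (invariant t) (new-has-k t) sizes new-full total
      where
        X = A t
        Z = new t
        sizes : ∣ X ∣ + ∣ Z ∣ ≡ N
        sizes = trans (sym (∣∪∣ X (ready t))) (∑-cong vs (λ v → cong ⟦_⟧ (all v)))
        new-full : E Z X + E Z Z ≡ d * ∣ Z ∣
        new-full = begin
            E Z X + E Z Z                      ≡⟨ ∑-+ vs _ _ ⟨
            ∑ vs (λ v → ⟦ Z v ⟧ * nb X v + ⟦ Z v ⟧ * nb Z v)
              ≡⟨ ∑-cong vs (λ v → *-distribˡ-+ ⟦ Z v ⟧ (nb X v) (nb Z v)) ⟨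
            ∑ vs (λ v → ⟦ Z v ⟧ * (nb X v + nb Z v))
              ≡⟨ ∑-cong vs (λ v → cong (⟦ Z v ⟧ *_) (trans (sym (nb-∪ X (ready t) v)) (nb-complete all v))) ⟩
            ∑ vs (λ v → ⟦ Z v ⟧ * d)          ≡⟨ ∑-cong vs (λ v → *-comm ⟦ Z v ⟧ d) ⟩
            ∑ vs (λ v → d * ⟦ Z v ⟧)          ≡⟨ ∑-*ˡ vs d _ ⟩
            d * ∣ Z ∣                          ∎
          where open ≡-Reasoning
        total : (E X X + E Z X) + (E Z X + E Z Z) ≡ d * N
        total = begin
            (E X X + E Z X) + (E Z X + E Z Z) ≡⟨ cong (λ x → (E X X + x) + (E Z X + E Z Z)) (E-sym adj-sym Z X) ⟩
            (E X X + E X Z) + (E Z X + E Z Z) ≡⟨ E-∪ X (ready t) ⟨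
            E (A (suc t)) (A (suc t))         ≡⟨ E-complete all ⟩
            d * N                             ∎
          where open ≡-Reasoning
    stalled : ∀ t → ∣ new t ∣ ≡ 0 → (∀ v → A (suc t) v ≡ true) → ∀ v → A t v ≡ true
    stalled t none all v =
      not-new (A t v) (ready t v) (all v) (≤-trans (∈⇒≤∑ (λ u → ⟦ new t u ⟧) (vs-complete v)) (≤-reflexive none))
      where
        not-new : ∀ a c → a ∨ c ≡ true → ⟦ not a ∧ c ⟧ ≤ 0 → a ≡ true
        not-new true  c     _  _  = refl
        not-new false true  _  ()
        not-new false false () _

    lower-bound : Percolates k S → ∣ S ∣ ≡ N ⊎ 2 * k * N + d ≤ 2 * k * ∣ S ∣ + d * N + k
    lower-bound (t , all) = from t all
      where
        from : ∀ t → (∀ v → A t v ≡ true) → ∣ S ∣ ≡ N ⊎ 2 * k * N + d ≤ 2 * k * ∣ S ∣ + d * N + k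
        from zero    all = inj₁ (∑-cong vs (λ v → cong ⟦_⟧ (all v)))
        from (suc t) all with ∣ new t ∣ in D≡
        ... | zero  = from t (stalled t D≡ all)
        ... | suc _ = inj₂ (last-step t all (≤-trans (s≤s z≤n) (≤-reflexive (sym D≡))))

-- Upper bound by an activation schedule: if every vertex outside S has
-- at least k neighbours of strictly smaller rank, then a vertex of rank
-- r is active by time r + 1, so S percolates.

module Schedule {V : Set} (vs : List V) (adj : V → V → Bool) (k : ℕ) (S : V → Bool)
                (rank : V → ℕ)
                (scheduled : ∀ v → S v ≡ true ⊎ k ≤ Activation.activeNbrs vs adj (λ u → rank u <ᵇ rank v) v) where

  open Activation vs adj
  open Counting vs adj

  seed-active : ∀ v → S v ≡ true → ∀ t → active k S t v ≡ true
  seed-active v seed zero    = seed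
  seed-active v seed (suc t) rewrite seed-active v seed t = refl

  active-by-rank : ∀ t v → rank v < t → active k S t v ≡ true
  active-by-rank (suc t) v r<t with scheduled v
  ... | inj₁ seed = seed-active v seed (suc t)
  ... | inj₂ k≤earlier =
    Equivalence.to T-≡ (Equivalence.from T-∨ (inj₂ (≤⇒≤ᵇ (≤-trans k≤earlier (activeNbrs-mono v earlier-active)))))
    where
      earlier-active : ∀ u → T (rank u <ᵇ rank v) → T (active k S t u)
      earlier-active u u<v =
        Equivalence.from T-≡ (active-by-rank t u (<-≤-trans (<ᵇ⇒< (rank u) (rank v) u<v) (≤-pred r<t)))

  percolates : ∀ B → (∀ v → rank v < B) → Percolates k S
  percolates B bounded = B , λ v → active-by-rank B v (bounded v)

module Cordalis (m n : ℕ) where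

  Link : CVertex m n → CVertex m n → Set
  Link a b = b ≡ down m n a ⊎ a ≡ down m n b ⊎ b ≡ right m n a ⊎ a ≡ right m n b

  cAdj-sym : ∀ a b → cAdj m n a b ≡ cAdj m n b a
  cAdj-sym a b = cong₂ _∧_ (cong not (⌊≟⌋-sym _≟ᵛ_ a b))
                           (∨-swap ⌊ b ≟ᵛ down m n a ⌋ ⌊ a ≟ᵛ down m n b ⌋ ⌊ b ≟ᵛ right m n a ⌋ ⌊ a ≟ᵛ right m n b ⌋)
    where
      ∨-swap : ∀ p q r s → p ∨ (q ∨ (r ∨ s)) ≡ q ∨ (p ∨ (s ∨ r))
      ∨-swap true  true  r s = refl
      ∨-swap true  false r s = refl
      ∨-swap false true  r s = refl
      ∨-swap false false r s = ∨-comm r s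

  link? : CVertex m n → CVertex m n → Bool
  link? a b = ⌊ b ≟ᵛ down m n a ⌋ ∨ ⌊ a ≟ᵛ down m n b ⌋ ∨ ⌊ b ≟ᵛ right m n a ⌋ ∨ ⌊ a ≟ᵛ right m n b ⌋

  cAdj-elim : ∀ {a b} → T (cAdj m n a b) → a ≢ b × Link a b
  cAdj-elim {a} {b} adj with Equivalence.to (T-∧ {not ⌊ a ≟ᵛ b ⌋} {link? a b}) adj
  ... | a≢b , link = toWitnessFalse {a? = a ≟ᵛ b} a≢b , links link
    where
      links : T (link? a b) → Link a b
      links l with Equivalence.to (T-∨ {⌊ b ≟ᵛ down m n a ⌋}) l
      ... | inj₁ p = inj₁ (toWitness p)
      ... | inj₂ q with Equivalence.to (T-∨ {⌊ a ≟ᵛ down m n b ⌋}) q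
      ...   | inj₁ p = inj₂ (inj₁ (toWitness p))
      ...   | inj₂ r with Equivalence.to (T-∨ {⌊ b ≟ᵛ right m n a ⌋}) r
      ...     | inj₁ p = inj₂ (inj₂ (inj₁ (toWitness p)))
      ...     | inj₂ p = inj₂ (inj₂ (inj₂ (toWitness p)))

  cAdj-intro : ∀ {a b} → a ≢ b → Link a b → T (cAdj m n a b)
  cAdj-intro {a} {b} a≢b link =
    Equivalence.from (T-∧ {not ⌊ a ≟ᵛ b ⌋} {link? a b}) (fromWitnessFalse a≢b , links link)
    where
      b↓a a↓b b→a a→b : Bool
      b↓a = ⌊ b ≟ᵛ down m n a ⌋
      a↓b = ⌊ a ≟ᵛ down m n b ⌋
      b→a = ⌊ b ≟ᵛ right m n a ⌋
      a→b = ⌊ a ≟ᵛ right m n b ⌋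
      inl : ∀ x y → T x → T (x ∨ y)
      inl x y p = Equivalence.from (T-∨ {x} {y}) (inj₁ p)
      inr : ∀ x y → T y → T (x ∨ y)
      inr x y p = Equivalence.from (T-∨ {x} {y}) (inj₂ p)
      links : Link a b → T (link? a b)
      links (inj₁ p)               = inl b↓a _ (fromWitness p)
      links (inj₂ (inj₁ p))        = inr b↓a _ (inl a↓b _ (fromWitness p))
      links (inj₂ (inj₂ (inj₁ p))) = inr b↓a _ (inr a↓b _ (inl b→a a→b (fromWitness p)))
      links (inj₂ (inj₂ (inj₂ p))) = inr b↓a _ (inr a↓b _ (inr b→a a→b (fromWitness p)))

  vertices-unique : Unique (cVertices m n)
  vertices-unique = cartesianProduct⁺ (allFin⁺ m) (allFin⁺ n)

  vertices-complete : ∀ v → v ∈ cVertices m n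
  vertices-complete (i , j) = ∈-cartesianProduct⁺ (∈-allFin i) (∈-allFin j)

m+1≤3m : ∀ k → (3 + k) + 1 ≤ (3 + k) * 3
m+1≤3m k = ≤-trans (m≤m+n _ (5 + 2 * k)) (≤-reflexive (identity k))
  where
    identity : ∀ k → (3 + k) + 1 + (5 + 2 * k) ≡ (3 + k) * 3
    identity = solve-∀

more-than-a-third : ∀ m s → 2 * 3 * (m * 3) + 4 ≤ 2 * 3 * s + 4 * (m * 3) + 3 → m + 1 ≤ s
more-than-a-third m s ineq = subst (_≤ s) (+-comm 1 m) (*-cancelˡ-< 6 m s 6m<6s)
  where
    lhs : ∀ m → 2 * 3 * (m * 3) + 4 ≡ (4 * (m * 3) + 3) + (1 + 6 * m)
    lhs = solve-∀
    rhs : ∀ m s → 2 * 3 * s + 4 * (m * 3) + 3 ≡ (4 * (m * 3) + 3) + 6 * s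
    rhs = solve-∀
    6m<6s : 6 * m < 6 * s
    6m<6s = +-cancelˡ-≤ (4 * (m * 3) + 3) _ _ (subst₂ _≤_ (lhs m) (rhs m s) ineq)

module Cordalis3 (k : ℕ) where

  m : ℕ
  m = 3 + k

  V : Set
  V = CVertex m 3

  open Cordalis m 3

  next prev : Fin m → Fin m
  next = sucMod m
  prev zero    = fromℕ (2 + k)
  prev (suc i) = inject₁ i

  next-row : ∀ i → toℕ (next i) ≡ suc (toℕ i) ⊎ (suc (toℕ i) ≡ m × toℕ (next i) ≡ 0)
  next-row i with m≤n⇒m<n∨m≡n (toℕ<n i)
  ... | inj₁ inner = inj₁ (trans (toℕ-fromℕ< _) (m<n⇒m%n≡m inner))
  ... | inj₂ last  = inj₂ (last , trans (toℕ-fromℕ< _) (trans (cong (_% m) last) (n%n≡0 m)))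

  prev-row : ∀ i {y} → toℕ i ≡ suc y → toℕ (prev i) ≡ y
  prev-row (suc i) refl = toℕ-inject₁ i

  next-prev : ∀ i → next (prev i) ≡ i
  next-prev i with next-row (prev i)
  next-prev zero    | inj₁ e =
    contradiction (trans e (cong suc (toℕ-fromℕ (2 + k)))) (<⇒≢ (toℕ<n (next (prev zero))))
  next-prev zero    | inj₂ (_ , e) = toℕ-injective e
  next-prev (suc i) | inj₁ e = toℕ-injective (trans e (cong suc (toℕ-inject₁ i)))
  next-prev (suc i) | inj₂ (last , _) =
    contradiction (trans (sym (cong suc (toℕ-inject₁ i))) last) (<⇒≢ (toℕ<n (suc i)))

  prev-next : ∀ i → prev (next i) ≡ i
  prev-next i with next-row i
  ... | inj₁ e          = toℕ-injective (prev-row (next i) e)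
  ... | inj₂ (last , e) = toℕ-injective (trans (prev-of-zero (next i) e) (suc-injective (sym last)))
    where
      prev-of-zero : ∀ j → toℕ j ≡ 0 → toℕ (prev j) ≡ 2 + k
      prev-of-zero zero _ = toℕ-fromℕ (2 + k)

  m≢1 : 1 ≢ m
  m≢1 ()

  m≢2 : 2 ≢ m
  m≢2 ()

  next-moves : ∀ i → next i ≢ i
  next-moves i e with next-row i
  ... | inj₁ e₁          = 1+n≢n (trans (sym e₁) (cong toℕ e))
  ... | inj₂ (last , e₁) = m≢1 (trans (cong suc (trans (sym e₁) (cong toℕ e))) last)

  next²-moves : ∀ i → next (next i) ≢ i
  next²-moves i e with next-row i | next-row (next i)
  ... | inj₁ e₁ | inj₁ e₂ =
    <⇒≢ (m<n⇒m<1+n (n<1+n (toℕ i))) (trans (sym (cong toℕ e)) (trans e₂ (cong suc e₁)))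
  ... | inj₁ e₁ | inj₂ (last₂ , e₂) =
    m≢2 (trans (cong suc (trans (cong suc (trans (sym e₂) (cong toℕ e))) (sym e₁))) last₂)
  ... | inj₂ (last₁ , e₁) | inj₁ e₂ =
    m≢2 (trans (cong suc (trans (cong suc (sym e₁)) (trans (sym e₂) (cong toℕ e)))) last₁)
  ... | inj₂ (last₁ , e₁) | inj₂ (last₂ , e₂) = m≢1 (trans (cong suc (sym e₁)) last₂)

  dn up rt lf : V → V
  dn = down m 3
  rt = right m 3
  up (i , j) = (prev i , j)
  lf (i , zero)             = (prev i , suc (suc zero))
  lf (i , suc zero)         = (i , zero)
  lf (i , suc (suc zero))   = (i , suc zero)

  up-dn : ∀ v → up (dn v) ≡ v
  up-dn (i , j) = cong (_, j) (prev-next i)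

  dn-up : ∀ v → dn (up v) ≡ v
  dn-up (i , j) = cong (_, j) (next-prev i)

  lf-rt : ∀ v → lf (rt v) ≡ v
  lf-rt (i , zero)           = refl
  lf-rt (i , suc zero)       = refl
  lf-rt (i , suc (suc zero)) = cong (_, suc (suc zero)) (prev-next i)

  rt-lf : ∀ v → rt (lf v) ≡ v
  rt-lf (i , zero)           = cong (_, zero) (next-prev i)
  rt-lf (i , suc zero)       = refl
  rt-lf (i , suc (suc zero)) = refl

  v≢dn : ∀ v → v ≢ dn v
  v≢dn (i , j) e = next-moves i (sym (cong proj₁ e))

  v≢up : ∀ v → v ≢ up v
  v≢up (i , j) e = next-moves i (trans (cong next (cong proj₁ e)) (next-prev i))

  dn≢up : ∀ v → dn v ≢ up v
  dn≢up (i , j) e = next²-moves i (trans (cong next (cong proj₁ e)) (next-prev i))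

  rt-column : ∀ v → proj₂ (rt v) ≢ proj₂ v
  rt-column (i , zero)           ()
  rt-column (i , suc zero)       ()
  rt-column (i , suc (suc zero)) ()

  lf-column : ∀ v → proj₂ (lf v) ≢ proj₂ v
  lf-column (i , zero)           ()
  lf-column (i , suc zero)       ()
  lf-column (i , suc (suc zero)) ()

  rt-lf-columns : ∀ v → proj₂ (rt v) ≢ proj₂ (lf v)
  rt-lf-columns (i , zero)           ()
  rt-lf-columns (i , suc zero)       ()
  rt-lf-columns (i , suc (suc zero)) ()

  neighbours : V → List V
  neighbours v = dn v ∷ up v ∷ rt v ∷ lf v ∷ []

  neighbours-unique : ∀ v → Unique (neighbours v)
  neighbours-unique v =
    (dn≢up v ∷ column (λ e → rt-column v (sym e)) ∷ column (λ e → lf-column v (sym e)) ∷ []) ∷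
    (column (λ e → rt-column v (sym e)) ∷ column (λ e → lf-column v (sym e)) ∷ []) ∷
    (column (rt-lf-columns v) ∷ []) ∷ [] ∷ []
    where
      column : ∀ {a b : V} → proj₂ a ≢ proj₂ b → a ≢ b
      column c e = c (cong proj₂ e)

  v≢rt : ∀ v → v ≢ rt v
  v≢rt v e = rt-column v (cong proj₂ (sym e))

  v≢lf : ∀ v → v ≢ lf v
  v≢lf v e = lf-column v (cong proj₂ (sym e))

  adjacent⇒neighbour : ∀ v u → T (cAdj m 3 v u) → u ∈ neighbours v
  adjacent⇒neighbour v u adj with proj₂ (cAdj-elim adj)
  ... | inj₁ u≡dn               = here u≡dn
  ... | inj₂ (inj₁ v≡dn)        = there (here (trans (sym (up-dn u)) (cong up (sym v≡dn))))
  ... | inj₂ (inj₂ (inj₁ u≡rt)) = there (there (here u≡rt))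
  ... | inj₂ (inj₂ (inj₂ v≡rt)) = there (there (there (here (trans (sym (lf-rt u)) (cong lf (sym v≡rt))))))

  neighbour⇒adjacent : ∀ v u → u ∈ neighbours v → T (cAdj m 3 v u)
  neighbour⇒adjacent v u (here refl)                       = cAdj-intro (v≢dn v) (inj₁ refl)
  neighbour⇒adjacent v u (there (here refl))               = cAdj-intro (v≢up v) (inj₂ (inj₁ (sym (dn-up v))))
  neighbour⇒adjacent v u (there (there (here refl)))       = cAdj-intro (v≢rt v) (inj₂ (inj₂ (inj₁ refl)))
  neighbour⇒adjacent v u (there (there (there (here refl)))) =
    cAdj-intro (v≢lf v) (inj₂ (inj₂ (inj₂ (sym (rt-lf v)))))

  open TorusCordalis m 3

  activeNbrs≡ : ∀ B v → activeNbrs B v ≡ ⟦ B (dn v) ⟧ + (⟦ B (up v) ⟧ + (⟦ B (rt v) ⟧ + (⟦ B (lf v) ⟧ + 0)))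
  activeNbrs≡ B v =
    activeNbrs-list _≟ᵛ_ (cAdj m 3) vertices-unique vertices-complete v (neighbours-unique v)
                    (adjacent⇒neighbour v) (neighbour⇒adjacent v) B

  regular : ∀ v → activeNbrs (λ _ → true) v ≡ 4
  regular = activeNbrs≡ (λ _ → true)

  order : Counting.N (cVertices m 3) (cAdj m 3) ≡ m * 3
  order = trans (∑-cartesianProduct (allFin m) (allFin 3) (λ _ → 1)) (∑-tabulate-const m (λ i → i) 3)

  even : ℕ → Bool
  even zero    = true
  even (suc x) = not (even x)

  ρ : ℕ → Fin 3 → ℕ
  ρ x       zero             = if even x then 0 else 1
  ρ zero    (suc zero)       = 1
  ρ (suc x) (suc zero)       = if even x then 0 else 2
  ρ zero    (suc (suc zero)) = 0
  ρ (suc x) (suc (suc zero)) = suc (suc x)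

  rank : V → ℕ
  rank (i , j) = ρ (toℕ i) j

  seed : V → Bool
  seed v = rank v ≡ᵇ 0

  ρ₀-even : ∀ {x} → even x ≡ true → ρ x zero ≡ 0
  ρ₀-even e rewrite e = refl

  ρ₀-odd : ∀ {x} → even x ≡ false → ρ x zero ≡ 1
  ρ₀-odd e rewrite e = refl

  ρ₁-odd : ∀ {y} → even y ≡ true → ρ (suc y) (suc zero) ≡ 0
  ρ₁-odd e rewrite e = refl

  ρ₁-even : ∀ {y} → even y ≡ false → ρ (suc y) (suc zero) ≡ 2
  ρ₁-even e rewrite e = refl

  ρ₀≤1 : ∀ x → ρ x zero ≤ 1
  ρ₀≤1 x with even x
  ... | true  = z≤n
  ... | false = ≤-refl

  ρ₁≤2 : ∀ x → ρ x (suc zero) ≤ 2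
  ρ₁≤2 zero = s≤s z≤n
  ρ₁≤2 (suc x) with even x
  ... | true  = z≤n
  ... | false = ≤-refl

  ρ₂≤ : ∀ x → ρ x (suc (suc zero)) ≤ suc x
  ρ₂≤ zero    = z≤n
  ρ₂≤ (suc x) = ≤-refl

  seeds-in-row : ∀ x → ⟦ ρ x zero ≡ᵇ 0 ⟧ + (⟦ ρ x (suc zero) ≡ᵇ 0 ⟧ + (⟦ ρ x (suc (suc zero)) ≡ᵇ 0 ⟧ + 0))
                       ≡ 1 + ⟦ x ≡ᵇ 0 ⟧
  seeds-in-row zero = refl
  seeds-in-row (suc y) with even y
  ... | true  = refl
  ... | false = refl

  open Counting (cVertices m 3) (cAdj m 3)

  seed-count : ∣ seed ∣ ≡ m + 1
  seed-count = begin
      ∣ seed ∣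
        ≡⟨ ∑-cartesianProduct (allFin m) (allFin 3) (λ v → ⟦ seed v ⟧) ⟩
      ∑ (allFin m) (λ i → ∑ (allFin 3) (λ j → ⟦ rank (i , j) ≡ᵇ 0 ⟧))
        ≡⟨ ∑-cong (allFin m) (λ i → seeds-in-row (toℕ i)) ⟩
      ∑ (allFin m) (λ i → 1 + ⟦ toℕ i ≡ᵇ 0 ⟧)
        ≡⟨ ∑-+ (allFin m) (λ _ → 1) (λ i → ⟦ toℕ i ≡ᵇ 0 ⟧) ⟩
      ∑ (allFin m) (λ _ → 1) + ∑ (allFin m) (λ i → ⟦ toℕ i ≡ᵇ 0 ⟧)
        ≡⟨ cong₂ _+_ (∑-tabulate-const m (λ i → i) 1) (cong suc (later-rows {2 + k} (λ i → i))) ⟩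
      m * 1 + 1
        ≡⟨ cong (_+ 1) (*-identityʳ m) ⟩
      m + 1 ∎
    where
      open ≡-Reasoning
      later-rows : ∀ {n p} (g : Fin n → Fin p) → ∑ (tabulate (λ i → suc (g i))) (λ i → ⟦ toℕ i ≡ᵇ 0 ⟧) ≡ 0
      later-rows {zero}  g = refl
      later-rows {suc n} g = later-rows (λ i → g (suc i))

  data ThreeOf (P : V → Set) (v : V) : Set where
    all-but-lf : P (dn v) → P (up v) → P (rt v) → ThreeOf P v
    all-but-rt : P (dn v) → P (up v) → P (lf v) → ThreeOf P v
    all-but-up : P (dn v) → P (rt v) → P (lf v) → ThreeOf P v
    all-but-dn : P (up v) → P (rt v) → P (lf v) → ThreeOf P v

  three-active : ∀ {P} B v → (∀ u → P u → T (B u)) → ThreeOf P v → 3 ≤ activeNbrs B v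
  three-active {P} B v P⇒B three = ≤-trans (count three) (≤-reflexive (sym (activeNbrs≡ B v)))
    where
      one : ∀ {u} → P u → 1 ≤ ⟦ B u ⟧
      one {u} p with B u | P⇒B u p
      ... | true | _ = ≤-refl
      count : ThreeOf P v → 3 ≤ ⟦ B (dn v) ⟧ + (⟦ B (up v) ⟧ + (⟦ B (rt v) ⟧ + (⟦ B (lf v) ⟧ + 0)))
      count (all-but-lf d u r) = +-mono-≤ (one d) (+-mono-≤ (one u) (+-mono-≤ (one r) z≤n))
      count (all-but-rt d u l) = +-mono-≤ (one d) (+-mono-≤ (one u) (m≤n⇒m≤o+n ⟦ B (rt v) ⟧ (+-mono-≤ (one l) z≤n)))
      count (all-but-up d r l) = +-mono-≤ (one d) (m≤n⇒m≤o+n ⟦ B (up v) ⟧ (+-mono-≤ (one r) (+-mono-≤ (one l) z≤n)))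
      count (all-but-dn u r l) = m≤n⇒m≤o+n ⟦ B (dn v) ⟧ (+-mono-≤ (one u) (+-mono-≤ (one r) (+-mono-≤ (one l) z≤n)))

  record _≺_ (u v : V) : Set where
    constructor ≺-intro
    field rank< : rank u < rank v

  ≺-by : ∀ {u v a b} → rank u ≤ a → a < b → rank v ≡ b → u ≺ v
  ≺-by ru≤a a<b refl = ≺-intro (≤-<-trans ru≤a a<b)

  at-row : ∀ {i x} j → toℕ i ≡ x → rank (i , j) ≡ ρ x j
  at-row j x≡ = cong (λ x → ρ x j) x≡

  rank-dn : ∀ i j → rank (dn (i , j)) ≡ ρ (suc (toℕ i)) j ⊎ (suc (toℕ i) ≡ m × rank (dn (i , j)) ≡ ρ 0 j)
  rank-dn i j with next-row i
  ... | inj₁ e          = inj₁ (at-row j e)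
  ... | inj₂ (last , e) = inj₂ (last , at-row j e)

  rank-up : ∀ i j {y} → toℕ i ≡ suc y → rank (up (i , j)) ≡ ρ y j
  rank-up i j x≡ = at-row j (prev-row i x≡)

  column₀ : ∀ i x → toℕ i ≡ x → rank (i , zero) ≡ 0 ⊎ ThreeOf (_≺ (i , zero)) (i , zero)
  column₀ i zero    x≡ = inj₁ (at-row zero x≡)
  column₀ i (suc y) x≡ with even y in e
  ... | false = inj₁ (trans (at-row zero x≡) (ρ₀-even {suc y} (cong not e)))
  ... | true  = inj₂ (all-but-lf by-dn by-up by-rt)
    where
      rank-v : rank (i , zero) ≡ 1
      rank-v = trans (at-row zero x≡) (ρ₀-odd {suc y} (cong not e))
      by-dn : dn (i , zero) ≺ (i , zero)
      by-dn with rank-dn i zero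
      ... | inj₁ d = ≺-by (≤-reflexive (trans d (trans (cong (λ x → ρ (suc x) zero) x≡)
                                                          (ρ₀-even {suc (suc y)} (cong not (cong not e))))))
                          (s≤s z≤n) rank-v
      ... | inj₂ (_ , d) = ≺-by (≤-reflexive d) (s≤s z≤n) rank-v
      by-up : up (i , zero) ≺ (i , zero)
      by-up = ≺-by (≤-reflexive (trans (rank-up i zero x≡) (ρ₀-even {y} e))) (s≤s z≤n) rank-v
      by-rt : rt (i , zero) ≺ (i , zero)
      by-rt = ≺-by (≤-reflexive (trans (at-row (suc zero) x≡) (ρ₁-odd {y} e))) (s≤s z≤n) rank-v

  column₁ : ∀ i x → toℕ i ≡ x → rank (i , suc zero) ≡ 0 ⊎ ThreeOf (_≺ (i , suc zero)) (i , suc zero)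
  column₁ i zero x≡ = inj₂ (all-but-up by-dn (≺-by (≤-reflexive (at-row (suc (suc zero)) x≡)) (s≤s z≤n) rank-v)
                                              (≺-by (≤-reflexive (at-row zero x≡)) (s≤s z≤n) rank-v))
    where
      rank-v : rank (i , suc zero) ≡ 1
      rank-v = at-row (suc zero) x≡
      by-dn : dn (i , suc zero) ≺ (i , suc zero)
      by-dn with rank-dn i (suc zero)
      ... | inj₁ d          = ≺-by (≤-reflexive (trans d (cong (λ x → ρ (suc x) (suc zero)) x≡))) (s≤s z≤n) rank-v
      ... | inj₂ (last , _) = contradiction (trans (cong suc (sym x≡)) last) m≢1
  column₁ i (suc zero) x≡ = inj₁ (at-row (suc zero) x≡)
  column₁ i (suc (suc z)) x≡ with even z in e
  ... | false = inj₁ (trans (at-row (suc zero) x≡) (ρ₁-odd {suc z} (cong not e)))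
  ... | true  = inj₂ (all-but-rt by-dn by-up by-lf)
    where
      rank-v : rank (i , suc zero) ≡ 2
      rank-v = trans (at-row (suc zero) x≡) (ρ₁-even {suc z} (cong not e))
      by-dn : dn (i , suc zero) ≺ (i , suc zero)
      by-dn with rank-dn i (suc zero)
      ... | inj₁ d = ≺-by (≤-reflexive (trans d (trans (cong (λ x → ρ (suc x) (suc zero)) x≡)
                                                          (ρ₁-odd {suc (suc z)} (cong not (cong not e))))))
                          (s≤s z≤n) rank-v
      ... | inj₂ (_ , d) = ≺-by (≤-reflexive d) (s≤s (s≤s z≤n)) rank-v
      by-up : up (i , suc zero) ≺ (i , suc zero)
      by-up = ≺-by (≤-reflexive (trans (rank-up i (suc zero) x≡) (ρ₁-odd {z} e))) (s≤s z≤n) rank-v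
      by-lf : lf (i , suc zero) ≺ (i , suc zero)
      by-lf = ≺-by (≤-reflexive (trans (at-row zero x≡) (ρ₀-even {suc (suc z)} (cong not (cong not e))))) (s≤s z≤n) rank-v

  column₂ : ∀ i x → toℕ i ≡ x → rank (i , suc (suc zero)) ≡ 0 ⊎ ThreeOf (_≺ (i , suc (suc zero))) (i , suc (suc zero))
  column₂ i zero    x≡ = inj₁ (at-row (suc (suc zero)) x≡)
  column₂ i (suc y) x≡ = inj₂ (all-but-dn by-up by-rt by-lf)
    where
      v = (i , suc (suc zero))
      rank-v : rank v ≡ suc (suc y)
      rank-v = at-row (suc (suc zero)) x≡
      by-up : up v ≺ v
      by-up = ≺-by (≤-trans (≤-reflexive (rank-up i (suc (suc zero)) x≡)) (ρ₂≤ y)) ≤-refl rank-v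
      by-rt : rt v ≺ v
      by-rt = ≺-by (ρ₀≤1 (toℕ (next i))) (s≤s (s≤s z≤n)) rank-v
      by-lf : lf v ≺ v
      by-lf = ≺-by (≤-reflexive (at-row (suc zero) x≡)) (ρ₁< y) rank-v
        where
          ρ₁< : ∀ y → ρ (suc y) (suc zero) < suc (suc y)
          ρ₁< zero    = s≤s z≤n
          ρ₁< (suc y) = ≤-<-trans (ρ₁≤2 (suc (suc y))) (s≤s (s≤s (s≤s z≤n)))

  column : ∀ v → rank v ≡ 0 ⊎ ThreeOf (_≺ v) v
  column (i , zero)           = column₀ i (toℕ i) refl
  column (i , suc zero)       = column₁ i (toℕ i) refl
  column (i , suc (suc zero)) = column₂ i (toℕ i) refl

  scheduled : ∀ v → seed v ≡ true ⊎ 3 ≤ activeNbrs (λ u → rank u <ᵇ rank v) v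
  scheduled v with column v
  ... | inj₁ rank≡0 = inj₁ (cong (_≡ᵇ 0) rank≡0)
  ... | inj₂ three  = inj₂ (three-active (λ u → rank u <ᵇ rank v) v (λ u u≺v → <⇒<ᵇ (_≺_.rank< u≺v)) three)

  rank-bound : ∀ v → rank v < suc m
  rank-bound (i , zero)           = s≤s (≤-trans (ρ₀≤1 (toℕ i)) (s≤s z≤n))
  rank-bound (i , suc zero)       = s≤s (≤-trans (ρ₁≤2 (toℕ i)) (s≤s (s≤s z≤n)))
  rank-bound (i , suc (suc zero)) = s≤s (≤-trans (ρ₂≤ (toℕ i)) (toℕ<n i))

  seed-percolates : size seed ≡ m + 1 × Percolates 3 seed
  seed-percolates =
    trans (size≡∣∣ seed) seed-count ,
    Schedule.percolates (cVertices m 3) (cAdj m 3) 3 seed rank scheduled (suc m) rank-bound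

  seeds-needed : ∀ S → Percolates 3 S → m + 1 ≤ size S
  seeds-needed S perc =
    subst (m + 1 ≤_) (sym (size≡∣∣ S))
          (from-bound (LowerBound.lower-bound (cVertices m 3) (cAdj m 3) cAdj-sym vertices-complete
                                              3 S 4 (n≤1+n 3) regular perc))
    where
      from-bound : ∣ S ∣ ≡ N ⊎ 2 * 3 * N + 4 ≤ 2 * 3 * ∣ S ∣ + 4 * N + 3 → m + 1 ≤ ∣ S ∣
      from-bound (inj₁ all)   = ≤-trans (m+1≤3m k) (≤-reflexive (sym (trans all order)))
      from-bound (inj₂ bound) =
        more-than-a-third m ∣ S ∣ (subst (λ n → 2 * 3 * n + 4 ≤ 2 * 3 * ∣ S ∣ + 4 * n + 3) order bound)

theorem3p1 : (m : ℕ) → 3 ≤ m → MinSeedCordalis m 3 3 (m + 1)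
theorem3p1 (suc (suc (suc k))) (s≤s (s≤s (s≤s z≤n))) = (seed , seed-percolates) , seeds-needed
  where open Cordalis3 k
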